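{- The set $\{((\frac{12}{5},\frac{12}{5},6),|121213212123|)\}$ is a Pareto surface of the set of all real-valued instances $(a_1,a_2,a_3)$ with $a_1\ge\frac{12}{5}$, $a_2\ge\frac{12}{5}$, $a_3\ge 6$ and $\frac1{a_1}+\frac1{a_2}+\frac1{a_3}\le\frac56$.
   Context: A real-valued pinwheel instance is a finite sequence $A=(a_1,\dots,a_k)$ of real numbers $a_i\ge 1$; $a_i$ is the period of task $i$. A schedule is a map $S:\mathbb{Z}\to\{1,\dots,k\}$. $S$ is valid for $A$ if for every task $i$, every positive integer $l$ and every $m\in\mathbb{Z}$, there are at least $l$ integers $t$ with $m\le t< m+\lceil l a_i\rceil$ and $S(t)=i$. A periodic schedule written $|s_0s_1\cdots s_{p-1}|$ denotes the schedule $S(t)=s_{t \bmod p}$. For a set $I$ of instances, a Pareto surface of $I$ is an inclusion-minimal set $C$ of pairs $(B,S)$, where $B$ is an instance and $S$ is a schedule valid for $B$, such that for every instance $A\in I$ some pair $(B,S)\in C$ has $S$ valid for $A$. -}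

module Defs where

open import Level using (Level; 0ℓ) renaming (suc to lsuc)
open import Data.Nat as ℕ using (ℕ; zero; suc)
open import Data.Integer as ℤ using (ℤ; +_; -[1+_]; _%ℕ_)
open import Data.Integer.DivMod using (n%ℕd<d)
open import Data.Fin using (Fin; fromℕ<) renaming (zero to f0; suc to fs)
open import Data.Vec using (Vec; lookup; []; _∷_)
open import Data.Product using (Σ; _×_; _,_; proj₁; proj₂)
open import Relation.Binary.PropositionalEquality using (_≡_)
open import Relation.Binary.Core using (Rel)
open import Relation.Binary.Structures using (IsTotalOrder)
open import Relation.Nullary using (¬_; Dec; yes; no)
open import Algebra.Structures using (IsCommutativeRing)
open import Data.Fin.Properties using (_≟_)
open import Relation.Unary using (Pred; _⊆_)

-- An ordered field equipped with a ceiling function.  The real numbers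
-- ℝ (with the usual ⌈_⌉) form such a structure; the stdlib has no reals.

record OrderedField : Set₁ where
  infixl 6 _+_
  infixl 7 _*_
  infix 4 _≤_
  field
    Carrier  : Set
    _+_ _*_  : Carrier → Carrier → Carrier
    -_       : Carrier → Carrier
    0# 1#    : Carrier
    _⁻¹      : Carrier → Carrier
    _≤_      : Rel Carrier 0ℓ
    isCommutativeRing : IsCommutativeRing _≡_ _+_ _*_ -_ 0# 1#
    ⁻¹-inverse : ∀ x → ¬ (x ≡ 0#) → x * (x ⁻¹) ≡ 1#
    0≢1        : ¬ (0# ≡ 1#)
    isTotalOrder : IsTotalOrder _≡_ _≤_
    +-mono-≤   : ∀ {x y} z → x ≤ y → x + z ≤ y + z
    *-nonneg   : ∀ {x y} → 0# ≤ x → 0# ≤ y → 0# ≤ x * y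

module OrderedFieldOps (F : OrderedField) where
  open OrderedField F

  _<_ : Carrier → Carrier → Set
  x < y = (x ≤ y) × ¬ (x ≡ y)

  fromℕ : ℕ → Carrier
  fromℕ zero    = 0#
  fromℕ (suc n) = 1# + fromℕ n

  fromℤ : ℤ → Carrier
  fromℤ (+ n)     = fromℕ n
  fromℤ -[1+ n ]  = - (fromℕ (suc n))

record OrderedFieldWithCeiling : Set₁ where
  field
    orderedField : OrderedField
  open OrderedField orderedField
  open OrderedFieldOps orderedField
  field
    ⌈_⌉        : Carrier → ℤ
    ⌈⌉-upper   : ∀ x → x ≤ fromℤ ⌈ x ⌉
    ⌈⌉-least   : ∀ x → fromℤ (⌈ x ⌉ ℤ.- + 1) < x

module Pinwheel (F : OrderedFieldWithCeiling) where
  open OrderedFieldWithCeiling F using (⌈_⌉; orderedField)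
  open OrderedField orderedField
  open OrderedFieldOps orderedField

  -- an instance with k tasks (task i has period a i)
  Instance : ℕ → Set
  Instance k = Fin k → Carrier

  Schedule : ℕ → Set
  Schedule k = ℤ → Fin k

  countℕ : ∀ {k} → Schedule k → Fin k → ℤ → ℕ → ℕ
  countℕ S i m zero = 0
  countℕ S i m (suc n) with S m ≟ i
  ... | yes _ = suc (countℕ S i (m ℤ.+ + 1) n)
  ... | no  _ = countℕ S i (m ℤ.+ + 1) n

  count : ∀ {k} → Schedule k → Fin k → ℤ → ℤ → ℕ
  count S i m (+ n)    = countℕ S i m n
  count S i m -[1+ n ] = 0

  Valid : ∀ {k} → Instance k → Schedule k → Set
  Valid {k} A S = ∀ (i : Fin k) (l : ℕ) (m : ℤ) → 1 ℕ.≤ l →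
                  l ℕ.≤ count S i m ⌈ fromℕ l * A i ⌉

  Pair : ℕ → Set
  Pair k = Instance k × Schedule k

  Covers : ∀ {k} → Pred (Instance k) 0ℓ → Pred (Pair k) 0ℓ → Set
  Covers {k} I C = ∀ (A : Instance k) → I A →
                   Σ (Pair k) λ p → C p × Valid A (proj₂ p)

  IsParetoSurface : ∀ {k} → Pred (Instance k) 0ℓ → Pred (Pair k) 0ℓ → Set₁
  IsParetoSurface {k} I C =
    (∀ p → C p → Valid (proj₁ p) (proj₂ p)) ×
    Covers I C ×
    (∀ (C' : Pred (Pair k) 0ℓ) → C' ⊆ C → Covers I C' → C ⊆ C')

  periodic : ∀ {k p} → Vec (Fin k) (suc p) → Schedule k
  periodic {k} {p} w t = lookup w (fromℕ< (n%ℕd<d t (suc p)))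

  _÷_ : ℕ → ℕ → Carrier
  q ÷ r = fromℕ q * (fromℕ r ⁻¹)

  -- The data of Corollary 2 (tasks 1,2,3 are Fin 3 elements 0,1,2).

  t1 t2 t3 : Fin 3
  t1 = f0
  t2 = fs f0
  t3 = fs (fs f0)

  B₀ : Instance 3
  B₀ f0           = 12 ÷ 5
  B₀ (fs f0)      = 12 ÷ 5
  B₀ (fs (fs f0)) = fromℕ 6

  S₀ : Schedule 3
  S₀ = periodic (t1 ∷ t2 ∷ t1 ∷ t2 ∷ t1 ∷ t3 ∷ t2 ∷ t1 ∷ t2 ∷ t1 ∷ t2 ∷ t3 ∷ [])

  C₀ : Pred (Pair 3) 0ℓ
  C₀ p = p ≡ (B₀ , S₀)

  I₀ : Pred (Instance 3) 0ℓ
  I₀ a = (12 ÷ 5 ≤ a t1) × (12 ÷ 5 ≤ a t2) × (fromℕ 6 ≤ a t3) ×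
         (a t1 ⁻¹ + a t2 ⁻¹ + a t3 ⁻¹ ≤ 5 ÷ 6)

{-# OPTIONS --safe #-}
-- The schedule |121213212123| has period 12 and serves tasks 1, 2, 3 in 5, 5 and 2 slots of every
-- period. Evaluation over all 12 starting points and all window lengths below 12 shows that every
-- window of length n holds at least ⌊c n / 12⌋ slots of a task served c times per period; longer
-- windows split off a full period. A task of period a ≥ 12 / c must be served l times in every
-- window of length ⌈l a⌉ ≥ 12 l / c, and ⌊c ⌈l a⌉ / 12⌋ ≥ l, so the schedule is valid for every
-- instance dominating (12/5, 12/5, 6 = 12/2), which includes the whole set of instances. A singleton
-- cover of a nonempty set is automatically inclusion-minimal, and (6, 6, 6) lies in the set.
module Submission where

open import Algebra.Bundles using (CommutativeRing)
import Algebra.Properties.Ring as RingProperties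
open import Algebra.Structures using (IsCommutativeRing)
open import Data.Bool.Base using (if_then_else_)
open import Data.Empty using (⊥-elim)
open import Data.Fin.Base using (Fin; toℕ; fromℕ<)
open import Data.Fin.Patterns using (0F; 1F; 2F)
import Data.Fin.Properties as Fin
open import Data.Integer.Base as ℤ using (-[1+_]; _%ℕ_)
open import Data.Integer.DivMod using (n%ℕd<d)
open import Data.Nat.Base as ℕ using (ℕ; zero; suc; z<s; NonZero)
import Data.Nat.Properties as ℕ
open import Data.Nat.DivMod
  using (m%n<n; m%n≤n; n%n≡0; m<n⇒m%n≡m; %-distribˡ-+; m%n%n≡m%n; [m+n]%n≡m%n;
         [m+kn]%n≡m%n; m*n/n≡m; /-monoˡ-≤; +-distrib-/-∣ˡ)
open import Data.Nat.Divisibility using (n∣m*n)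
open import Data.Nat.Induction using (<-rec)
open import Data.Product.Base using (∃-syntax; _×_; _,_)
open import Data.Sum.Base using (inj₁; inj₂)
open import Data.Vec.Base using (Vec; []; _∷_; lookup)
open import Level using (0ℓ)
open import Relation.Binary.Bundles using (Poset)
open import Relation.Binary.PropositionalEquality
  using (_≡_; _≢_; refl; sym; trans; cong; cong₂; subst; subst₂; module ≡-Reasoning)
open import Relation.Binary.Structures using (IsTotalOrder)
open import Relation.Nullary.Decidable using (Dec; does; yes; no; _×-dec_; from-yes)
open import Relation.Nullary.Negation using (¬_; contradiction)
open import Relation.Unary using (Pred; _⊆_; Satisfiable)
open import Defs

module ModularArithmetic where
  open import Data.Nat.Base using (_+_; _*_; _∸_; _≤_; _<_; _/_; _%_)
  open ≡-Reasoning

  [m+n%d]%d≡[m+n]%d : ∀ m n d .{{_ : NonZero d}} → (m + n % d) % d ≡ (m + n) % d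
  [m+n%d]%d≡[m+n]%d m n d = begin
    (m + n % d) % d          ≡⟨ %-distribˡ-+ m (n % d) d ⟩
    (m % d + n % d % d) % d  ≡⟨ cong (λ x → (m % d + x) % d) (m%n%n≡m%n n d) ⟩
    (m % d + n % d) % d      ≡⟨ %-distribˡ-+ m n d ⟨
    (m + n) % d              ∎

  suc-%-cong : ∀ {m n} d .{{_ : NonZero d}} → m % d ≡ n % d → suc m % d ≡ suc n % d
  suc-%-cong {m} {n} d eq = begin
    suc m % d        ≡⟨ [m+n%d]%d≡[m+n]%d 1 m d ⟨
    (1 + m % d) % d  ≡⟨ cong (λ x → (1 + x) % d) eq ⟩
    (1 + n % d) % d  ≡⟨ [m+n%d]%d≡[m+n]%d 1 n d ⟩
    suc n % d        ∎

  [o+m]%d≡[o+n]%d⇒m≡n : ∀ {m n} o d .{{_ : NonZero d}} →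
                        m < d → n < d → (o + m) % d ≡ (o + n) % d → m ≡ n
  [o+m]%d≡[o+n]%d⇒m≡n {m} {n} o d m<d n<d eq = begin
    m                        ≡⟨ undo m<d ⟩
    (t + (o + m) % d) % d    ≡⟨ cong (λ x → (t + x) % d) eq ⟩
    (t + (o + n) % d) % d    ≡⟨ undo n<d ⟨
    n                        ∎
    where
    -- shifting further by t = o (d - 1) completes the shift by o to a multiple of d
    t = o * d ∸ o
    undo : ∀ {x} → x < d → x ≡ (t + (o + x) % d) % d
    undo {x} x<d = begin
      x                       ≡⟨ m<n⇒m%n≡m x<d ⟨
      x % d                   ≡⟨ [m+kn]%n≡m%n x o d ⟨
      (x + o * d) % d         ≡⟨ cong (_% d) (ℕ.+-comm x (o * d)) ⟩
      (o * d + x) % d         ≡⟨ cong (λ y → (y + x) % d) (ℕ.m∸n+n≡m (ℕ.m≤m*n o d)) ⟨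
      (t + o + x) % d         ≡⟨ cong (_% d) (ℕ.+-assoc t o x) ⟩
      (t + (o + x)) % d       ≡⟨ [m+n%d]%d≡[m+n]%d t (o + x) d ⟨
      (t + (o + x) % d) % d   ∎

  [1+m+-[1+m]%ℕd]%d≡0 : ∀ m d .{{_ : NonZero d}} → (suc m + -[1+ m ] %ℕ d) % d ≡ 0
  [1+m+-[1+m]%ℕd]%d≡0 m d with suc m % d in eq
  ... | zero  = trans (cong (_% d) (ℕ.+-identityʳ (suc m))) eq
  ... | suc r = begin
    (suc m + (d ∸ suc r)) % d      ≡⟨ cong (_% d) (ℕ.+-comm (suc m) (d ∸ suc r)) ⟩
    (d ∸ suc r + suc m) % d        ≡⟨ [m+n%d]%d≡[m+n]%d (d ∸ suc r) (suc m) d ⟨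
    (d ∸ suc r + suc m % d) % d    ≡⟨ cong (λ x → (d ∸ suc r + x) % d) eq ⟩
    (d ∸ suc r + suc r) % d        ≡⟨ cong (_% d) (ℕ.m∸n+n≡m (subst (_≤ d) eq (m%n≤n (suc m) d))) ⟩
    d % d                          ≡⟨ n%n≡0 d ⟩
    0                              ∎

  [m+1]%ℕd≡[1+m%ℕd]%d : ∀ m d .{{_ : NonZero d}} → (m ℤ.+ ℤ.+ 1) %ℕ d ≡ suc (m %ℕ d) % d
  [m+1]%ℕd≡[1+m%ℕd]%d (ℤ.+ m) d = begin
    (m + 1) % d        ≡⟨ cong (_% d) (ℕ.+-comm m 1) ⟩
    suc m % d          ≡⟨ [m+n%d]%d≡[m+n]%d 1 m d ⟨
    suc (m % d) % d    ∎
  [m+1]%ℕd≡[1+m%ℕd]%d -[1+ zero ] d@(suc _) = sym ([1+m+-[1+m]%ℕd]%d≡0 0 d)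
  [m+1]%ℕd≡[1+m%ℕd]%d -[1+ suc m ] d =
    [o+m]%d≡[o+n]%d⇒m≡n (suc m) d (n%ℕd<d -[1+ m ] d) (m%n<n _ d) (begin
      (suc m + -[1+ m ] %ℕ d) % d   ≡⟨ [1+m+-[1+m]%ℕd]%d≡0 m d ⟩
      0                             ≡⟨ [1+m+-[1+m]%ℕd]%d≡0 (suc m) d ⟨
      (suc (suc m) + s) % d         ≡⟨ cong (_% d) (ℕ.+-suc (suc m) s) ⟨
      (suc m + suc s) % d           ≡⟨ [m+n%d]%d≡[m+n]%d (suc m) (suc s) d ⟨
      (suc m + suc s % d) % d       ∎)
    where s = -[1+ suc m ] %ℕ d

  m*[n+o]/n≡m+m*o/n : ∀ m n o .{{_ : NonZero n}} → m * (n + o) / n ≡ m + m * o / n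
  m*[n+o]/n≡m+m*o/n m n o = begin
    m * (n + o) / n          ≡⟨ cong (_/ n) (ℕ.*-distribˡ-+ m n o) ⟩
    (m * n + m * o) / n      ≡⟨ +-distrib-/-∣ˡ (m * o) (n∣m*n m) ⟩
    m * n / n + m * o / n    ≡⟨ cong (_+ m * o / n) (m*n/n≡m m n) ⟩
    m + m * o / n            ∎

  m*n≤o⇒m≤o/n : ∀ {m o} n .{{_ : NonZero n}} → m * n ≤ o → m ≤ o / n
  m*n≤o⇒m≤o/n {m} n m*n≤o = subst (_≤ _) (m*n/n≡m m n) (/-monoˡ-≤ n m*n≤o)

open ModularArithmetic

tally : ∀ {a} {A : Set a} → Dec A → ℕ → ℕ
tally a? n = if does a? then suc n else n

tally-+ : ∀ {a} {A : Set a} (a? : Dec A) m n → tally a? (m ℕ.+ n) ≡ tally a? m ℕ.+ n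
tally-+ (yes _) m n = refl
tally-+ (no  _) m n = refl

module CyclicWord {k p : ℕ} (w : Vec (Fin k) (suc p)) where
  open import Data.Nat.Base using (_+_; _*_; _∸_; _≤_; _<_; _/_; _%_)

  residue : ℕ → Fin (suc p)
  residue r = fromℕ< (m%n<n r (suc p))

  letter : ℕ → Fin k
  letter r = lookup w (residue r)

  letter-cong : ∀ r s → r % suc p ≡ s % suc p → letter r ≡ letter s
  letter-cong r s eq = cong (lookup w) (Fin.fromℕ<-cong _ _ eq (m%n<n r _) (m%n<n s _))

  occurrences : Fin k → ℕ → ℕ → ℕ
  occurrences i r zero    = 0
  occurrences i r (suc n) = tally (letter r Fin.≟ i) (occurrences i (suc r) n)

  occurrences-cong : ∀ i r s n → r % suc p ≡ s % suc p →
                     occurrences i r n ≡ occurrences i s n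
  occurrences-cong i r s zero    eq = refl
  occurrences-cong i r s (suc n) eq =
    cong₂ (λ x → tally (x Fin.≟ i)) (letter-cong r s eq)
          (occurrences-cong i (suc r) (suc s) n (suc-%-cong (suc p) eq))

  occurrences-+ : ∀ i r m n →
                  occurrences i r (m + n) ≡ occurrences i r m + occurrences i (r + m) n
  occurrences-+ i r zero    n = cong (λ x → occurrences i x n) (sym (ℕ.+-identityʳ r))
  occurrences-+ i r (suc m) n = begin
    tally d (occurrences i (suc r) (m + n))
      ≡⟨ cong (tally d) (occurrences-+ i (suc r) m n) ⟩
    tally d (occurrences i (suc r) m + occurrences i (suc r + m) n)
      ≡⟨ tally-+ d _ _ ⟩
    tally d (occurrences i (suc r) m) + occurrences i (suc r + m) n
      ≡⟨ cong (λ x → tally d (occurrences i (suc r) m) + occurrences i x n) (ℕ.+-suc r m) ⟨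
    tally d (occurrences i (suc r) m) + occurrences i (r + suc m) n ∎
    where
    open ≡-Reasoning
    d = letter r Fin.≟ i

  occurrences-residue : ∀ i r n → occurrences i r n ≡ occurrences i (toℕ (residue r)) n
  occurrences-residue i r n = occurrences-cong i r _ n (begin
    r % suc p                  ≡⟨ m%n%n≡m%n r (suc p) ⟨
    r % suc p % suc p          ≡⟨ cong (_% suc p) (Fin.toℕ-fromℕ< (m%n<n r (suc p))) ⟨
    toℕ (residue r) % suc p    ∎)
    where open ≡-Reasoning

  occurrences-+-period : ∀ i r n → occurrences i (r + suc p) n ≡ occurrences i r n
  occurrences-+-period i r n = occurrences-cong i (r + suc p) r n ([m+n]%n≡m%n r (suc p))

  FairShare : Fin k → ℕ → Set
  FairShare i c = ∀ r n → c * n / suc p ≤ occurrences i r n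

  PeriodShare : Fin k → ℕ → Set
  PeriodShare i c =
    (∀ (r : Fin (suc p)) → occurrences i (toℕ r) (suc p) ≡ c) ×
    (∀ (r n : Fin (suc p)) → c * toℕ n / suc p ≤ occurrences i (toℕ r) (toℕ n))

  periodShare? : ∀ i c → Dec (PeriodShare i c)
  periodShare? i c =
    Fin.all? (λ r → occurrences i (toℕ r) (suc p) ℕ.≟ c) ×-dec
    Fin.all? (λ r → Fin.all? λ n → c * toℕ n / suc p ℕ.≤? occurrences i (toℕ r) (toℕ n))

  periodShare⇒fairShare : ∀ {i c} → PeriodShare i c → FairShare i c
  periodShare⇒fairShare {i} {c} (perPeriod , shortWindow) r = <-rec _ bound
    where
    P = suc p

    bound : ∀ n → (∀ {m} → m < n → c * m / P ≤ occurrences i r m) →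
            c * n / P ≤ occurrences i r n
    bound n rec with n ℕ.<? P
    ... | yes n<P rewrite occurrences-residue i r n =
      subst (λ x → c * x / P ≤ occurrences i (toℕ (residue r)) x) (Fin.toℕ-fromℕ< n<P)
            (shortWindow (residue r) (fromℕ< n<P))
    ... | no n≮P = subst (λ x → c * x / P ≤ occurrences i r x) (ℕ.m+[n∸m]≡n P≤n) (begin
      c * (P + m) / P                              ≡⟨ m*[n+o]/n≡m+m*o/n c P m ⟩
      c + c * m / P                                ≤⟨ ℕ.+-monoʳ-≤ c (rec (ℕ.∸-monoʳ-< z<s P≤n)) ⟩
      c + occurrences i r m                        ≡⟨ cong₂ _+_ perPeriod′ (occurrences-+-period i r m) ⟨
      occurrences i r P + occurrences i (r + P) m  ≡⟨ occurrences-+ i r P m ⟨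
      occurrences i r (P + m)                      ∎)
      where
      open ℕ.≤-Reasoning
      m = n ∸ P
      P≤n = ℕ.≮⇒≥ n≮P
      perPeriod′ : occurrences i r P ≡ c
      perPeriod′ = trans (occurrences-residue i r P) (perPeriod (residue r))

module OrderedFieldProperties (F : OrderedField) where
  open OrderedField F
  open OrderedFieldOps F
  open IsCommutativeRing isCommutativeRing
    using (+-assoc; +-comm; +-identityˡ; +-identityʳ; -‿inverseˡ; -‿inverseʳ;
           *-assoc; *-comm; *-identityˡ; *-identityʳ; distribˡ; distribʳ; zeroˡ; zeroʳ)
  open IsTotalOrder isTotalOrder using (antisym; total; isPartialOrder)
    renaming (refl to ≤-refl; trans to ≤-trans)

  commutativeRing : CommutativeRing 0ℓ 0ℓ
  commutativeRing = record { isCommutativeRing = isCommutativeRing }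

  open RingProperties (CommutativeRing.ring commutativeRing) using (-1*x≈-x; -‿involutive)

  open import Algebra.Properties.CommutativeSemigroup
    (CommutativeRing.*-commutativeSemigroup commutativeRing) using (x∙yz≈y∙xz)

  ≤-poset : Poset 0ℓ 0ℓ 0ℓ
  ≤-poset = record { isPartialOrder = isPartialOrder }

  x≤y⇒0≤y-x : ∀ {x y} → x ≤ y → 0# ≤ y + - x
  x≤y⇒0≤y-x {x} {y} x≤y = subst (_≤ y + - x) (-‿inverseʳ x) (+-mono-≤ (- x) x≤y)

  0≤-x⇒x≤0 : ∀ {x} → 0# ≤ - x → x ≤ 0#
  0≤-x⇒x≤0 {x} 0≤-x = subst₂ _≤_ (+-identityˡ x) (-‿inverseˡ x) (+-mono-≤ x 0≤-x)

  0≤d⇒x≤d+x : ∀ {d} x → 0# ≤ d → x ≤ d + x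
  0≤d⇒x≤d+x {d} x 0≤d = subst (_≤ d + x) (+-identityˡ x) (+-mono-≤ x 0≤d)

  -- (- 1#) * (- 1#) ≡ 1#, so 1# ≤ 0# would give 0# ≤ 1# as well
  0≤1 : 0# ≤ 1#
  0≤1 with total 0# 1#
  ... | inj₁ 0≤1 = 0≤1
  ... | inj₂ 1≤0 = contradiction (antisym 0≤1′ 1≤0) 0≢1
    where
    0≤-1 : 0# ≤ - 1#
    0≤-1 = subst (0# ≤_) (+-identityˡ (- 1#)) (x≤y⇒0≤y-x 1≤0)
    0≤1′ : 0# ≤ 1#
    0≤1′ = subst (0# ≤_) (trans (-1*x≈-x (- 1#)) (-‿involutive 1#)) (*-nonneg 0≤-1 0≤-1)

  *-monoˡ-≤-nonNeg : ∀ {c x y} → 0# ≤ c → x ≤ y → c * x ≤ c * y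
  *-monoˡ-≤-nonNeg {c} {x} {y} 0≤c x≤y =
    subst (c * x ≤_) c[y-x]+cx≡cy (0≤d⇒x≤d+x (c * x) (*-nonneg 0≤c (x≤y⇒0≤y-x x≤y)))
    where
    open ≡-Reasoning
    c[y-x]+cx≡cy : c * (y + - x) + c * x ≡ c * y
    c[y-x]+cx≡cy = begin
      c * (y + - x) + c * x  ≡⟨ distribˡ c (y + - x) x ⟨
      c * (y + - x + x)      ≡⟨ cong (c *_) (+-assoc y (- x) x) ⟩
      c * (y + (- x + x))    ≡⟨ cong (λ z → c * (y + z)) (-‿inverseˡ x) ⟩
      c * (y + 0#)           ≡⟨ cong (c *_) (+-identityʳ y) ⟩
      c * y                  ∎

  *-monoʳ-≤-nonNeg : ∀ {c x y} → 0# ≤ c → x ≤ y → x * c ≤ y * c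
  *-monoʳ-≤-nonNeg {c} {x} {y} 0≤c x≤y =
    subst₂ _≤_ (*-comm c x) (*-comm c y) (*-monoˡ-≤-nonNeg 0≤c x≤y)

  fromℕ-homo-+ : ∀ m n → fromℕ (m ℕ.+ n) ≡ fromℕ m + fromℕ n
  fromℕ-homo-+ zero    n = sym (+-identityˡ (fromℕ n))
  fromℕ-homo-+ (suc m) n = trans (cong (1# +_) (fromℕ-homo-+ m n)) (sym (+-assoc 1# _ _))

  fromℕ-homo-* : ∀ m n → fromℕ (m ℕ.* n) ≡ fromℕ m * fromℕ n
  fromℕ-homo-* zero    n = sym (zeroˡ (fromℕ n))
  fromℕ-homo-* (suc m) n = begin
    fromℕ (n ℕ.+ m ℕ.* n)                  ≡⟨ fromℕ-homo-+ n (m ℕ.* n) ⟩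
    fromℕ n + fromℕ (m ℕ.* n)              ≡⟨ cong₂ _+_ (sym (*-identityˡ _)) (fromℕ-homo-* m n) ⟩
    1# * fromℕ n + fromℕ m * fromℕ n       ≡⟨ distribʳ (fromℕ n) 1# (fromℕ m) ⟨
    (1# + fromℕ m) * fromℕ n               ∎
    where open ≡-Reasoning

  fromℕ-nonNeg : ∀ n → 0# ≤ fromℕ n
  fromℕ-nonNeg zero    = ≤-refl
  fromℕ-nonNeg (suc n) =
    ≤-trans 0≤1 (subst (1# ≤_) (+-comm _ _) (0≤d⇒x≤d+x 1# (fromℕ-nonNeg n)))

  fromℕ-mono-≤ : ∀ {m n} → m ℕ.≤ n → fromℕ m ≤ fromℕ n
  fromℕ-mono-≤ {m} {n} m≤n =
    subst (fromℕ m ≤_) [n-m]+m≡n (0≤d⇒x≤d+x (fromℕ m) (fromℕ-nonNeg (n ℕ.∸ m)))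
    where
    [n-m]+m≡n : fromℕ (n ℕ.∸ m) + fromℕ m ≡ fromℕ n
    [n-m]+m≡n = trans (sym (fromℕ-homo-+ (n ℕ.∸ m) m)) (cong fromℕ (ℕ.m∸n+n≡m m≤n))

  1+x≰x : ∀ x → ¬ (1# + x ≤ x)
  1+x≰x x 1+x≤x =
    0≢1 (antisym 0≤1 (subst₂ _≤_ 1+x-x≡1 (-‿inverseʳ x) (+-mono-≤ (- x) 1+x≤x)))
    where
    1+x-x≡1 : 1# + x + - x ≡ 1#
    1+x-x≡1 = trans (+-assoc 1# x (- x)) (trans (cong (1# +_) (-‿inverseʳ x)) (+-identityʳ 1#))

  fromℕ-cancel-≤ : ∀ {m n} → fromℕ m ≤ fromℕ n → m ℕ.≤ n
  fromℕ-cancel-≤ {m} {n} fm≤fn with m ℕ.≤? n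
  ... | yes m≤n = m≤n
  ... | no  m≰n = ⊥-elim (1+x≰x (fromℕ n) (≤-trans (fromℕ-mono-≤ (ℕ.≰⇒> m≰n)) fm≤fn))

  fromℕ-suc≰0 : ∀ n → ¬ (fromℕ (suc n) ≤ 0#)
  fromℕ-suc≰0 n fn≤0 with fromℕ-cancel-≤ {suc n} {0} fn≤0
  ... | ()

  fromℕ-suc≢0 : ∀ n → fromℕ (suc n) ≢ 0#
  fromℕ-suc≢0 n d≡0 = fromℕ-suc≰0 n (subst (_≤ 0#) (sym d≡0) ≤-refl)

  fromℕ-suc-⁻¹-nonNeg : ∀ n → 0# ≤ fromℕ (suc n) ⁻¹
  fromℕ-suc-⁻¹-nonNeg n with total 0# (fromℕ (suc n) ⁻¹)
  ... | inj₁ 0≤x⁻¹ = 0≤x⁻¹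
  ... | inj₂ x⁻¹≤0 = contradiction (antisym 0≤1 1≤0) 0≢1
    where
    1≤0 : 1# ≤ 0#
    1≤0 = subst₂ _≤_ (⁻¹-inverse _ (fromℕ-suc≢0 n)) (zeroʳ _)
                     (*-monoˡ-≤-nonNeg (fromℕ-nonNeg (suc n)) x⁻¹≤0)

  fromℕ-suc-*-⁻¹ : ∀ n x → fromℕ (suc n) * (x * fromℕ (suc n) ⁻¹) ≡ x
  fromℕ-suc-*-⁻¹ n x = begin
    d * (x * d ⁻¹)   ≡⟨ x∙yz≈y∙xz d x (d ⁻¹) ⟩
    x * (d * d ⁻¹)   ≡⟨ cong (x *_) (⁻¹-inverse d (fromℕ-suc≢0 n)) ⟩
    x * 1#           ≡⟨ *-identityʳ x ⟩
    x                ∎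
    where
    open ≡-Reasoning
    d = fromℕ (suc n)

  ÷-≤⇒≤-* : ∀ q d {a} → fromℕ q * fromℕ (suc d) ⁻¹ ≤ a → fromℕ q ≤ fromℕ (suc d) * a
  ÷-≤⇒≤-* q d q/d≤a =
    subst (_≤ _) (fromℕ-suc-*-⁻¹ d (fromℕ q)) (*-monoˡ-≤-nonNeg (fromℕ-nonNeg (suc d)) q/d≤a)

  fromℕ-suc-* : ∀ n x → fromℕ (suc n) * x ≡ x + fromℕ n * x
  fromℕ-suc-* n x = trans (distribʳ x 1# (fromℕ n)) (cong (_+ fromℕ n * x) (*-identityˡ x))

  x+x+x≡3*x : ∀ x → x + x + x ≡ fromℕ 3 * x
  x+x+x≡3*x x = begin
    x + x + x                ≡⟨ +-assoc x x x ⟩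
    x + (x + x)              ≡⟨ cong (λ z → x + (x + z)) 1*x≡x ⟨
    x + (x + fromℕ 1 * x)    ≡⟨ cong (x +_) (fromℕ-suc-* 1 x) ⟨
    x + fromℕ 2 * x          ≡⟨ fromℕ-suc-* 2 x ⟨
    fromℕ 3 * x              ∎
    where
    open ≡-Reasoning
    1*x≡x : fromℕ 1 * x ≡ x
    1*x≡x = trans (fromℕ-suc-* 0 x) (trans (cong (x +_) (zeroˡ x)) (+-identityʳ x))

  fromℕ-*-cancel-≤ : ∀ P c l k {a} → fromℕ P ≤ fromℕ c * a → fromℕ l * a ≤ fromℕ k →
                     l ℕ.* P ℕ.≤ c ℕ.* k
  fromℕ-*-cancel-≤ P c l k {a} P≤ca la≤k = fromℕ-cancel-≤ (begin
    fromℕ (l ℕ.* P)          ≡⟨ fromℕ-homo-* l P ⟩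
    fromℕ l * fromℕ P        ≤⟨ *-monoˡ-≤-nonNeg (fromℕ-nonNeg l) P≤ca ⟩
    fromℕ l * (fromℕ c * a)  ≡⟨ x∙yz≈y∙xz (fromℕ l) (fromℕ c) a ⟩
    fromℕ c * (fromℕ l * a)  ≤⟨ *-monoˡ-≤-nonNeg (fromℕ-nonNeg c) la≤k ⟩
    fromℕ c * fromℕ k        ≡⟨ fromℕ-homo-* c k ⟨
    fromℕ (c ℕ.* k)          ∎)
    where open import Relation.Binary.Reasoning.PartialOrder ≤-poset

  fromℕ-suc≤*⇒0≤ : ∀ p c {a} → fromℕ (suc p) ≤ fromℕ c * a → 0# ≤ a
  fromℕ-suc≤*⇒0≤ p c {a} P≤ca with total 0# a
  ... | inj₁ 0≤a = 0≤a
  ... | inj₂ a≤0 = ⊥-elim (fromℕ-suc≰0 p (≤-trans P≤ca ca≤0))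
    where
    ca≤0 : fromℕ c * a ≤ 0#
    ca≤0 = subst (fromℕ c * a ≤_) (zeroʳ (fromℕ c)) (*-monoˡ-≤-nonNeg (fromℕ-nonNeg c) a≤0)

  ÷-≤-fromℕ : ∀ q d n → q ℕ.≤ suc d ℕ.* n → fromℕ q * fromℕ (suc d) ⁻¹ ≤ fromℕ n
  ÷-≤-fromℕ q d n q≤dn = begin
    fromℕ q * D ⁻¹                ≤⟨ *-monoʳ-≤-nonNeg (fromℕ-suc-⁻¹-nonNeg d) (fromℕ-mono-≤ q≤dn) ⟩
    fromℕ (suc d ℕ.* n) * D ⁻¹    ≡⟨ cong (_* D ⁻¹) (fromℕ-homo-* (suc d) n) ⟩
    D * fromℕ n * D ⁻¹            ≡⟨ *-assoc D (fromℕ n) (D ⁻¹) ⟩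
    D * (fromℕ n * D ⁻¹)          ≡⟨ fromℕ-suc-*-⁻¹ d (fromℕ n) ⟩
    fromℕ n                       ∎
    where
    open import Relation.Binary.Reasoning.PartialOrder ≤-poset
    D = fromℕ (suc d)

module PeriodicSchedules (F : OrderedFieldWithCeiling) where
  open OrderedFieldWithCeiling F
  open OrderedField orderedField
  open OrderedFieldOps orderedField
  open OrderedFieldProperties orderedField
  open Pinwheel F
  open IsTotalOrder isTotalOrder using () renaming (trans to ≤-trans)

  ⌈⌉-nonNeg : ∀ {x} → 0# ≤ x → ∃[ k ] ⌈ x ⌉ ≡ ℤ.+ k
  ⌈⌉-nonNeg {x} 0≤x with ⌈ x ⌉ | ⌈⌉-upper x
  ... | ℤ.+ k    | _          = k , refl
  ... | -[1+ j ] | x≤-[1+j] = ⊥-elim (fromℕ-suc≰0 j (0≤-x⇒x≤0 (≤-trans 0≤x x≤-[1+j])))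

  countℕ-suc : ∀ {k} (S : Schedule k) i m n →
               countℕ S i m (suc n) ≡ tally (S m Fin.≟ i) (countℕ S i (m ℤ.+ ℤ.+ 1) n)
  countℕ-suc S i m n with S m Fin.≟ i
  ... | yes _ = refl
  ... | no  _ = refl

  module _ {k p} (w : Vec (Fin k) (suc p)) where
    open CyclicWord w

    countℕ-periodic : ∀ i m r n → r ℕ.% suc p ≡ m %ℕ suc p →
                      countℕ (periodic w) i m n ≡ occurrences i r n
    countℕ-periodic i m r zero    r≡m = refl
    countℕ-periodic i m r (suc n) r≡m = begin
      countℕ (periodic w) i m (suc n)
        ≡⟨ countℕ-suc (periodic w) i m n ⟩
      tally (periodic w m Fin.≟ i) (countℕ (periodic w) i (m ℤ.+ ℤ.+ 1) n)
        ≡⟨ cong₂ (λ x → tally (x Fin.≟ i)) periodic-m≡letter-r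
                 (countℕ-periodic i (m ℤ.+ ℤ.+ 1) (suc r) n 1+r≡m+1) ⟩
      tally (letter r Fin.≟ i) (occurrences i (suc r) n) ∎
      where
      open ≡-Reasoning
      periodic-m≡letter-r : periodic w m ≡ letter r
      periodic-m≡letter-r = cong (lookup w) (Fin.fromℕ<-cong _ _ (sym r≡m) _ _)
      1+r≡m+1 : suc r ℕ.% suc p ≡ (m ℤ.+ ℤ.+ 1) %ℕ suc p
      1+r≡m+1 = begin
        suc r ℕ.% suc p                ≡⟨ suc-%-cong (suc p) (trans r≡m (sym (m<n⇒m%n≡m (n%ℕd<d m (suc p))))) ⟩
        suc (m %ℕ suc p) ℕ.% suc p     ≡⟨ [m+1]%ℕd≡[1+m%ℕd]%d m (suc p) ⟨
        (m ℤ.+ ℤ.+ 1) %ℕ suc p         ∎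

    valid-periodic : (A : Instance k) (c : Fin k → ℕ) →
                     (∀ i → FairShare i (c i)) → (∀ i → fromℕ (suc p) ≤ fromℕ (c i) * A i) →
                     Valid A (periodic w)
    valid-periodic A c fair rate i l m _
      with ⌈⌉-nonNeg (*-nonneg (fromℕ-nonNeg l) (fromℕ-suc≤*⇒0≤ p (c i) (rate i)))
    ... | k , ⌈la⌉≡k rewrite ⌈la⌉≡k = begin
      l                                ≤⟨ m*n≤o⇒m≤o/n (suc p) (fromℕ-*-cancel-≤ (suc p) (c i) l k (rate i) la≤k) ⟩
      c i ℕ.* k ℕ./ suc p              ≤⟨ fair i (m %ℕ suc p) k ⟩
      occurrences i (m %ℕ suc p) k     ≡⟨ countℕ-periodic i m _ k (m<n⇒m%n≡m (n%ℕd<d m (suc p))) ⟨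
      countℕ (periodic w) i m k        ∎
      where
      open ℕ.≤-Reasoning
      la≤k : fromℕ l * A i ≤ fromℕ k
      la≤k = subst (λ z → fromℕ l * A i ≤ fromℤ z) ⌈la⌉≡k (⌈⌉-upper (fromℕ l * A i))

  singleton-minimal : ∀ {k} {I : Pred (Instance k) 0ℓ} {q : Pair k} → Satisfiable I →
                      ∀ C → C ⊆ (_≡ q) → Covers I C → (_≡ q) ⊆ C
  singleton-minimal (A , A∈I) C C⊆q cover refl with cover A A∈I
  ... | q′ , q′∈C , _ with C⊆q q′∈C
  ... | refl = q′∈C

word₀ : Vec (Fin 3) 12
word₀ = 0F ∷ 1F ∷ 0F ∷ 1F ∷ 0F ∷ 2F ∷ 1F ∷ 0F ∷ 1F ∷ 0F ∷ 1F ∷ 2F ∷ []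

share₀ : Fin 3 → ℕ
share₀ 0F = 5
share₀ 1F = 5
share₀ 2F = 2

fairShare₀ : ∀ i → CyclicWord.FairShare word₀ i (share₀ i)
fairShare₀ i = periodShare⇒fairShare (from-yes (Fin.all? λ j → periodShare? j (share₀ j)) i)
  where open CyclicWord word₀

module Schedule₀ (F : OrderedFieldWithCeiling) where
  open OrderedFieldWithCeiling F using (orderedField)
  open OrderedField orderedField
  open OrderedFieldOps orderedField
  open OrderedFieldProperties orderedField
  open Pinwheel F
  open PeriodicSchedules F
  open IsTotalOrder isTotalOrder using () renaming (refl to ≤-refl)

  rate₀ : ∀ {A : Instance 3} → (∀ i → B₀ i ≤ A i) → ∀ i → fromℕ 12 ≤ fromℕ (share₀ i) * A i
  rate₀ B₀≤A 0F = ÷-≤⇒≤-* 12 4 (B₀≤A 0F)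
  rate₀ B₀≤A 1F = ÷-≤⇒≤-* 12 4 (B₀≤A 1F)
  rate₀ {A} B₀≤A 2F =
    subst (_≤ fromℕ 2 * A 2F) (sym (fromℕ-homo-* 2 6)) (*-monoˡ-≤-nonNeg (fromℕ-nonNeg 2) (B₀≤A 2F))

  valid-above-B₀ : ∀ A → (∀ i → B₀ i ≤ A i) → Valid A S₀
  valid-above-B₀ A B₀≤A = valid-periodic word₀ A share₀ fairShare₀ (rate₀ B₀≤A)

  valid-B₀ : Valid B₀ S₀
  valid-B₀ = valid-above-B₀ B₀ (λ _ → ≤-refl)

  I₀⇒above-B₀ : ∀ {A : Instance 3} → I₀ A → ∀ i → B₀ i ≤ A i
  I₀⇒above-B₀ (B₀≤A₁ , _      , _      , _) 0F = B₀≤A₁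
  I₀⇒above-B₀ (_      , B₀≤A₂ , _      , _) 1F = B₀≤A₂
  I₀⇒above-B₀ (_      , _      , B₀≤A₃ , _) 2F = B₀≤A₃

  A₀ : Instance 3
  A₀ _ = fromℕ 6

  A₀∈I₀ : I₀ A₀
  A₀∈I₀ = 12/5≤6 , 12/5≤6 , ≤-refl , 3/6≤5/6
    where
    12/5≤6 : 12 ÷ 5 ≤ fromℕ 6
    12/5≤6 = ÷-≤-fromℕ 12 4 6 (ℕ.m≤m+n 12 18)
    3/6≤5/6 : fromℕ 6 ⁻¹ + fromℕ 6 ⁻¹ + fromℕ 6 ⁻¹ ≤ 5 ÷ 6
    3/6≤5/6 = subst (_≤ 5 ÷ 6) (sym (x+x+x≡3*x _))
                (*-monoʳ-≤-nonNeg (fromℕ-suc-⁻¹-nonNeg 5) (fromℕ-mono-≤ (ℕ.m≤m+n 3 2)))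

corollary2 : (F : OrderedFieldWithCeiling) → Pinwheel.IsParetoSurface F (Pinwheel.I₀ F) (Pinwheel.C₀ F)
corollary2 F =
    (λ { _ refl → valid-B₀ })
  , (λ A A∈I₀ → (B₀ , S₀) , refl , valid-above-B₀ A (I₀⇒above-B₀ A∈I₀))
  , singleton-minimal (A₀ , A₀∈I₀)
  where
  open Pinwheel F
  open PeriodicSchedules F
  open Schedule₀ F
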